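{- Let $k\geq 2$, let $z\in\mathbb{N}^k$ and let $R=z+\mathbb{N}^k=\{z+w: w\in\mathbb{N}^k\}$. Suppose $A\subseteq\mathbb{N}^k$ is complete with respect to $R$, i.e. $R\subseteq FS(A)$. Then for every $i\in\{1,\dots,k\}$, the projection of $A$ onto the $i$-th axis, i.e. the set $A_i=\{x_i : (x_1,\dots,x_k)\in A\}\subseteq\mathbb{N}$, is thick.
   Context: $\mathbb{N}=\{1,2,\dots\}$ denotes the positive integers. For $X\subseteq\mathbb{N}^k$, $FS(X)=\{\sum_{i}\varepsilon_i x_i : x_i\in X \text{ distinct},\ \varepsilon_i\in\{0,1\},\ \sum_i\varepsilon_i<\infty\}$ is the set of finite sums of distinct elements of $X$. An infinite set $A=\{a_1<a_2<\cdots\}\subseteq\mathbb{N}$ is called weakly thin if $\limsup_{n\to\infty}\frac{\log a_n}{\log n}=\infty$ (equivalently, its counting function satisfies $A(n)=|A\cap[1,n]|=n^{g(n)}$ with $\liminf_{n\to\infty} g(n)=0$). A set $B\subseteq\mathbb{N}$ is called thick if it is not weakly thin. -}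

module Defs where

open import Data.Nat using (ℕ; zero; suc; _+_; _≤_; _<_; _^_)
open import Data.Fin using (Fin)
open import Data.Vec using (Vec; zipWith; replicate; lookup)
import Data.Vec.Relation.Unary.All as VAll
open import Data.List using (List; length; foldr)
open import Data.List.Relation.Unary.All using (All)
open import Data.List.Relation.Unary.Unique.Propositional using (Unique)
open import Data.Product using (Σ; ∃; _×_)
open import Relation.Binary.PropositionalEquality using (_≡_)
open import Relation.Nullary using (¬_)

-- vectors in ℕ^k (ℕ = positive integers): all coordinates ≥ 1
Pos : ∀ {k} → Vec ℕ k → Set
Pos = VAll.All (λ x → 1 ≤ x)

_+ᵛ_ : ∀ {k} → Vec ℕ k → Vec ℕ k → Vec ℕ k
_+ᵛ_ = zipWith _+_

vsum : ∀ {k} → List (Vec ℕ k) → Vec ℕ k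
vsum {k} = foldr _+ᵛ_ (replicate k 0)

FS : ∀ {k} → (Vec ℕ k → Set) → Vec ℕ k → Set
FS {k} A v = Σ (List (Vec ℕ k)) λ xs → All A xs × Unique xs × vsum xs ≡ v

Proj : ∀ {k} → (Vec ℕ k → Set) → Fin k → ℕ → Set
Proj {k} A i m = Σ (Vec ℕ k) λ x → A x × lookup x i ≡ m

InfiniteSet : (ℕ → Set) → Set
InfiniteSet B = ∀ m → Σ ℕ λ b → B b × m < b

-- B has at least n elements in [1,m], i.e. (for infinite B) a_n ≤ m
AtLeastBelow : (ℕ → Set) → ℕ → ℕ → Set
AtLeastBelow B n m = Σ (List ℕ) λ xs → length xs ≡ n × Unique xs × All (λ b → B b × b ≤ m) xs

-- limsup log a_n / log n = ∞  ⇔  ∀ M, for infinitely many n, a_n > n^M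
WeaklyThin : (ℕ → Set) → Set
WeaklyThin B = InfiniteSet B ×
  (∀ (M N : ℕ) → Σ ℕ λ n → N ≤ n × ¬ AtLeastBelow B n (n ^ M))

Thick : (ℕ → Set) → Set
Thick B = ¬ WeaklyThin B

-- Fix a coordinate j ≠ i and apply completeness to z + w, where w is 1 except for m + 1 in
-- coordinate i. Every summand has j-th coordinate at least 1, so there are at most t = z_j + 1 of
-- them, and their i-th coordinates are elements of A_i summing to z_i + m + 1. Thus every integer
-- above z_i is a sum of at most t elements of A_i. Counting such sums, A_i has at least n elements
-- up to z_i + n^t + 1 ≤ n^(t+1) for all large n, which is incompatible with weak thinness.

module Submission where

open import Data.Nat using (ℕ; zero; suc; _+_; _*_; _^_; _≤_; _<_; z≤n; s≤s)
open import Data.Nat.Properties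
open import Data.Nat.ListAction using (sum)
open import Data.Fin as Fin using (Fin; punchIn)
open import Data.Fin.Properties using (punchInᵢ≢i)
open import Data.List using (List; []; _∷_; [_]; _++_; length; map; concat; applyUpTo; take; cartesianProductWith; deduplicate)
open import Data.List.Properties using (length-map; length-++; length-applyUpTo; length-take; length-removeAt′)
open import Data.List.Membership.Propositional using (_∈_)
open import Data.List.Membership.Propositional.Properties
  using (∈-cartesianProductWith⁺; ∈-concat⁺′; ∈-concat⁻′; ∈-applyUpTo⁺; ∈-applyUpTo⁻; ∈-deduplicate⁺; ∈-deduplicate⁻)
open import Data.List.Relation.Unary.Any using (here; there; index; _─_)
open import Data.List.Relation.Unary.All as All using (All; []; _∷_)
import Data.List.Relation.Unary.All.Properties as All
open import Data.List.Relation.Unary.AllPairs using ([]; _∷_)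
open import Data.List.Relation.Unary.Unique.Propositional using (Unique)
import Data.List.Relation.Unary.Unique.Propositional.Properties as Unique
open import Data.List.Relation.Unary.Unique.DecPropositional.Properties _≟_ using (deduplicate-!)
open import Data.Vec using (Vec; lookup; replicate; _[_]≔_)
open import Data.Vec.Properties using (lookup-zipWith; lookup-replicate; lookup∘update; lookup∘update′)
import Data.Vec.Relation.Unary.All as VAll
import Data.Vec.Relation.Unary.All.Properties as VAll
open import Data.Product using (Σ; _×_; _,_; proj₁)
open import Relation.Binary.PropositionalEquality using (_≡_; _≢_; refl; sym; trans; cong; cong₂; subst; subst₂; module ≡-Reasoning)
open import Relation.Nullary using (¬_)
open import Data.Empty using (⊥-elim)
open import Function using (_∘_)
open import Defs

∈-─⁺ : ∀ {A : Set} {x y : A} {ys} (p : x ∈ ys) → y ∈ ys → y ≢ x → y ∈ (ys ─ p)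
∈-─⁺ (here refl) (here refl) y≢x = ⊥-elim (y≢x refl)
∈-─⁺ (here refl) (there q)   _   = q
∈-─⁺ (there p)   (here refl) _   = here refl
∈-─⁺ (there p)   (there q)   y≢x = there (∈-─⁺ p q y≢x)

Unique⇒length-≤ : ∀ {A : Set} {xs ys : List A} → Unique xs → All (_∈ ys) xs → length xs ≤ length ys
Unique⇒length-≤ [] [] = z≤n
Unique⇒length-≤ {ys = ys} (x∉xs ∷ xs!) (x∈ys ∷ xs⊆ys) =
  subst (_ ≤_) (sym (length-removeAt′ ys (index x∈ys)))
    (s≤s (Unique⇒length-≤ xs! (All.zipWith (λ (x≢y , y∈ys) → ∈-─⁺ x∈ys y∈ys (x≢y ∘ sym)) (x∉xs , xs⊆ys))))

∈⇒≤sum : ∀ {n ns} → n ∈ ns → n ≤ sum ns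
∈⇒≤sum {ns = m ∷ ms} (here refl) = m≤m+n m (sum ms)
∈⇒≤sum {ns = m ∷ ms} (there n∈ms) = ≤-trans (∈⇒≤sum n∈ms) (m≤n+m (sum ms) m)

length-cartesianProductWith : ∀ {A B C : Set} (f : A → B → C) xs ys →
  length (cartesianProductWith f xs ys) ≡ length xs * length ys
length-cartesianProductWith f []       ys = refl
length-cartesianProductWith f (x ∷ xs) ys = begin
  length (map (f x) ys ++ cartesianProductWith f xs ys) ≡⟨ length-++ (map (f x) ys) ⟩
  length (map (f x) ys) + length (cartesianProductWith f xs ys)
    ≡⟨ cong₂ _+_ (length-map (f x) ys) (length-cartesianProductWith f xs ys) ⟩
  length ys + length xs * length ys ∎
  where open ≡-Reasoning

-- Padding with 0 makes these the sums of at most t entries of U, repetitions allowed.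
sumsOfAtMost : ℕ → List ℕ → List ℕ
sumsOfAtMost zero    U = [ 0 ]
sumsOfAtMost (suc t) U = cartesianProductWith _+_ (0 ∷ U) (sumsOfAtMost t U)

length-sumsOfAtMost : ∀ t U → length (sumsOfAtMost t U) ≡ suc (length U) ^ t
length-sumsOfAtMost zero    U = refl
length-sumsOfAtMost (suc t) U = trans (length-cartesianProductWith _+_ (0 ∷ U) (sumsOfAtMost t U))
  (cong (suc (length U) *_) (length-sumsOfAtMost t U))

sum∈sumsOfAtMost : ∀ {t U ys} → All (_∈ U) ys → length ys ≤ t → sum ys ∈ sumsOfAtMost t U
sum∈sumsOfAtMost {zero}      []           _           = here refl
sum∈sumsOfAtMost {suc t} {U} []           _           =
  ∈-cartesianProductWith⁺ _+_ {xs = 0 ∷ U} (here refl) (sum∈sumsOfAtMost {t} [] z≤n)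
sum∈sumsOfAtMost {suc t}     (y∈U ∷ ys⊆U) (s≤s len≤t) =
  ∈-cartesianProductWith⁺ _+_ (there y∈U) (sum∈sumsOfAtMost ys⊆U len≤t)

IsSumOfAtMost : (ℕ → Set) → ℕ → ℕ → Set
IsSumOfAtMost B t n = Σ (List ℕ) λ ys → All B ys × length ys ≤ t × sum ys ≡ n

AtLeastBelow-mono : ∀ {B n m m′} → m ≤ m′ → AtLeastBelow B n m → AtLeastBelow B n m′
AtLeastBelow-mono m≤m′ (xs , len≡n , xs! , bounded) =
  xs , len≡n , xs! , All.map (λ (b∈B , b≤m) → b∈B , ≤-trans b≤m m≤m′) bounded

Unique⇒AtLeastBelow : ∀ {B n m U} → Unique U → All (λ b → B b × b ≤ m) U → n ≤ length U →
                      AtLeastBelow B n m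
Unique⇒AtLeastBelow {n = n} {U = U} U! bounded n≤|U| =
  take n U , trans (length-take n U) (m≤n⇒m⊓n≡m n≤|U|) , Unique.take⁺ n U! , All.take⁺ n bounded

-- The X integers c + 1, …, c + X are among the (1 + |U|) ^ t sums of at most t elements of
-- U = B ∩ [1, c + X], so |U| ≥ n once X > n ^ t.
module _ {B : ℕ → Set} {t c : ℕ} (basis : ∀ m → IsSumOfAtMost B t (c + suc m)) where

  private
    summands : ℕ → List ℕ
    summands m = proj₁ (basis m)

  basis⇒AtLeastBelow : ∀ n X → n ^ t < X → AtLeastBelow B n (c + X)
  basis⇒AtLeastBelow n X n^t<X = Unique⇒AtLeastBelow (deduplicate-! pool) U-bounded n≤|U|
    where
    pool : List ℕ
    pool = concat (applyUpTo summands X)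

    U : List ℕ
    U = deduplicate _≟_ pool

    summands⊆U : ∀ {m} → m < X → All (_∈ U) (summands m)
    summands⊆U m<X = All.tabulate λ y∈ → ∈-deduplicate⁺ _≟_ (∈-concat⁺′ y∈ (∈-applyUpTo⁺ summands m<X))

    summand-bounded : ∀ {m b} → m < X → b ∈ summands m → B b × b ≤ c + X
    summand-bounded {m} m<X b∈ =
      let (_ , summands∈B , _ , sum≡) = basis m
      in All.lookup summands∈B b∈ , ≤-trans (∈⇒≤sum b∈) (≤-trans (≤-reflexive sum≡) (+-monoʳ-≤ c m<X))

    U-bounded : All (λ b → B b × b ≤ c + X) U
    U-bounded = All.tabulate λ b∈U → bounded (∈-concat⁻′ (applyUpTo summands X) (∈-deduplicate⁻ _≟_ pool b∈U))
      where
      bounded : ∀ {b} → Σ (List ℕ) (λ ys → b ∈ ys × ys ∈ applyUpTo summands X) → B b × b ≤ c + X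
      bounded (ys , b∈ys , ys∈) with ∈-applyUpTo⁻ summands ys∈
      ... | m , m<X , refl = summand-bounded m<X b∈ys

    targets : List ℕ
    targets = applyUpTo (λ m → c + suc m) X

    targets! : Unique targets
    targets! = Unique.applyUpTo⁺₁ _ X (λ i<j _ → <⇒≢ (+-monoʳ-< c (s≤s i<j)))

    targets⊆sums : All (_∈ sumsOfAtMost t U) targets
    targets⊆sums = All.applyUpTo⁺₁ _ X λ {m} m<X →
      let (_ , _ , len≤t , sum≡) = basis m
      in subst (_∈ sumsOfAtMost t U) sum≡ (sum∈sumsOfAtMost (summands⊆U m<X) len≤t)

    X≤[1+|U|]^t : X ≤ suc (length U) ^ t
    X≤[1+|U|]^t = subst₂ _≤_ (length-applyUpTo _ X) (length-sumsOfAtMost t U)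
      (Unique⇒length-≤ targets! targets⊆sums)

    n≤|U| : n ≤ length U
    n≤|U| = ≮⇒≥ λ |U|<n → <⇒≱ n^t<X (≤-trans X≤[1+|U|]^t (^-monoˡ-≤ t |U|<n))

m+[1+n^t]≤n^[1+t] : ∀ {m n} t → 2 + m ≤ n → m + suc (n ^ t) ≤ n ^ suc t
m+[1+n^t]≤n^[1+t] {m} {n@(suc _)} t 2+m≤n = begin
  m + suc q          ≡⟨ +-comm m (suc q) ⟩
  suc q + m          ≤⟨ +-mono-≤ (+-monoˡ-≤ q (m^n>0 n t)) (m≤m*n m q {{m^n≢0 n t}}) ⟩
  q + q + m * q      ≡⟨ +-assoc q q (m * q) ⟩
  (2 + m) * q        ≤⟨ *-monoˡ-≤ q 2+m≤n ⟩
  n * q              ∎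
  where
  open ≤-Reasoning
  q = n ^ t

All-replicate⁺ : ∀ {A : Set} {P : A → Set} {a} n → P a → VAll.All P (replicate n a)
All-replicate⁺ zero    _  = VAll.[]
All-replicate⁺ (suc n) pa = pa VAll.∷ All-replicate⁺ n pa

All-[]≔⁺ : ∀ {A : Set} {P : A → Set} {n a} {xs : Vec A n} i → VAll.All P xs → P a → VAll.All P (xs [ i ]≔ a)
All-[]≔⁺ Fin.zero    (_  VAll.∷ pxs) pa = pa VAll.∷ pxs
All-[]≔⁺ (Fin.suc i) (px VAll.∷ pxs) pa = px VAll.∷ All-[]≔⁺ i pxs pa

lookup-vsum : ∀ {k} (xs : List (Vec ℕ k)) i → lookup (vsum xs) i ≡ sum (map (λ x → lookup x i) xs)
lookup-vsum []       i = lookup-replicate i 0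
lookup-vsum (x ∷ xs) i = trans (lookup-zipWith _+_ i x (vsum xs)) (cong (lookup x i +_) (lookup-vsum xs i))

length≤lookup-vsum : ∀ {k} {xs : List (Vec ℕ k)} → All Pos xs → ∀ j → length xs ≤ lookup (vsum xs) j
length≤lookup-vsum []                            j = z≤n
length≤lookup-vsum {xs = x ∷ xs} (x⁺ ∷ xs⁺) j =
  subst (_ ≤_) (sym (lookup-zipWith _+_ j x (vsum xs))) (+-mono-≤ (VAll.lookup⁺ x⁺ j) (length≤lookup-vsum xs⁺ j))

FS⇒IsSumOfAtMost-Proj : ∀ {k A} {v : Vec ℕ k} → (∀ x → A x → Pos x) → FS A v → ∀ i j →
                        IsSumOfAtMost (Proj A i) (lookup v j) (lookup v i)
FS⇒IsSumOfAtMost-Proj A⁺ (xs , xs∈A , _ , refl) i j =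
  map (λ x → lookup x i) xs ,
  All.map⁺ (All.map (λ {x} x∈A → x , x∈A , refl) xs∈A) ,
  subst (_≤ _) (sym (length-map _ xs)) (length≤lookup-vsum (All.map (A⁺ _) xs∈A) j) ,
  sym (lookup-vsum xs i)

proposition1p1 : (k : ℕ) → 2 ≤ k → (z : Vec ℕ k) → Pos z →
    (A : Vec ℕ k → Set) → (∀ x → A x → Pos x) →
    (∀ w → Pos w → FS A (z +ᵛ w)) →
    (i : Fin k) → Thick (Proj A i)
proposition1p1 1 (s≤s ()) _ _ _ _ _ _
proposition1p1 k@(suc (suc _)) _ z _ A A⁺ complete i (_ , weaklyThin) = refute (weaklyThin (suc t) (2 + c))
  where
  j : Fin k
  j = punchIn i Fin.zero

  c t : ℕ
  c = lookup z i
  t = lookup z j + 1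

  -- w is 1 away from coordinate i, so the coordinate z_j + 1 of z + w bounds the number of summands.
  basis : ∀ m → IsSumOfAtMost (Proj A i) t (c + suc m)
  basis m = subst₂ (IsSumOfAtMost (Proj A i)) (lookup-+ᵛ j wⱼ≡1) (lookup-+ᵛ i (lookup∘update i ones (suc m)))
    (FS⇒IsSumOfAtMost-Proj A⁺ (complete w w⁺) i j)
    where
    ones w : Vec ℕ k
    ones = replicate k 1
    w = ones [ i ]≔ suc m

    w⁺ : Pos w
    w⁺ = All-[]≔⁺ i (All-replicate⁺ k ≤-refl) (s≤s z≤n)

    wⱼ≡1 : lookup w j ≡ 1
    wⱼ≡1 = trans (lookup∘update′ (punchInᵢ≢i i Fin.zero) ones (suc m)) (lookup-replicate j 1)

    lookup-+ᵛ : ∀ l {a} → lookup w l ≡ a → lookup (z +ᵛ w) l ≡ lookup z l + a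
    lookup-+ᵛ l wₗ≡a = trans (lookup-zipWith _+_ l z w) (cong (lookup z l +_) wₗ≡a)

  refute : ¬ Σ ℕ (λ n → 2 + c ≤ n × ¬ AtLeastBelow (Proj A i) n (n ^ suc t))
  refute (n , 2+c≤n , fewBelow) =
    fewBelow (AtLeastBelow-mono (m+[1+n^t]≤n^[1+t] t 2+c≤n) (basis⇒AtLeastBelow basis n (suc (n ^ t)) ≤-refl))
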